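{- Let $n,k,m$ be positive integers. Suppose there exist matchings $V^{(0)},\dots,V^{(m-1)}$ in $Q_n$ such that each $V^{(j)}$ is a Breaker pairing strategy for $\mathcal{Q}(n,k)$ and $\bigcup_{j=0}^{m-1}V^{(j)}$ equals the set of all edges of $Q_n$. Suppose moreover that there is a partition of $E_n$ into $m$ sets, and a partition of $O_n$ into $m$ sets, such that every subcube of $Q_n$ of dimension $n-k+2$ contains at least one vertex from each of the sets in each partition. Then there exists a Breaker pairing strategy for $\mathcal{Q}(4n,b)$, where $b=\max\{4k-3,\,n+1\}$.
   Context: $Q_n$ is the hypercube graph on $\{0,1\}^n$ (vertices adjacent iff they differ in exactly one coordinate). $E_n$ denotes the set of vectors in $\{0,1\}^n$ with an even number of $1$'s and $O_n$ the set with an odd number of $1$'s. A $d$-dimensional subcube of $Q_n$ is obtained by choosing $n-d$ coordinates and fixed values in $\{0,1\}$ for them, and taking all $2^d$ vectors agreeing with these fixed values. $\mathcal{Q}(n,k)$ is the hypergraph with vertex set $\{0,1\}^n$ whose edges are the $k$-dimensional subcubes of $Q_n$ (the Maker–Breaker game is played on it). Following the paper's convention, a Breaker pairing strategy for $\mathcal{Q}(n,k)$ is a matching $M$ in $Q_n$ such that every $k$-dimensional subcube of $Q_n$ contains both endpoints of at least one edge of $M$. -}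

module Defs where

open import Data.Nat using (ℕ; zero; suc; _+_)
open import Data.Bool using (Bool; true; false; _xor_)
open import Data.Maybe using (Maybe; just; nothing)
open import Data.Vec using (Vec; []; _∷_; lookup)
open import Data.Fin using (Fin)
open import Data.Product using (Σ; _×_; ∃; ∃-syntax)
open import Relation.Binary.PropositionalEquality using (_≡_; _≢_)
open import Level using (0ℓ)
open import Relation.Binary using (Rel)

Cube : ℕ → Set
Cube n = Vec Bool n

Adj : ∀ {n} → Cube n → Cube n → Set
Adj {n} u v = ∃[ i ] (lookup u i ≢ lookup v i
                × (∀ (j : Fin n) → j ≢ i → lookup u j ≡ lookup v j))

parity : ∀ {n} → Cube n → Bool
parity []       = false
parity (b ∷ bs) = b xor parity bs

InE : ∀ {n} → Cube n → Set
InE x = parity x ≡ false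

InO : ∀ {n} → Cube n → Set
InO x = parity x ≡ true

-- a subcube is described by a pattern: nothing = free coordinate,
-- just b = coordinate fixed to b
Pattern : ℕ → Set
Pattern n = Vec (Maybe Bool) n

dim : ∀ {n} → Pattern n → ℕ
dim []             = 0
dim (nothing ∷ p)  = suc (dim p)
dim (just _ ∷ p)   = dim p

_∈C_ : ∀ {n} → Cube n → Pattern n → Set
_∈C_ {n} x p = ∀ (i : Fin n) (b : Bool) → lookup p i ≡ just b → lookup x i ≡ b

EdgeSet : ℕ → Set₁
EdgeSet n = Rel (Cube n) 0ℓ

IsMatching : ∀ {n} → EdgeSet n → Set
IsMatching {n} M =
    (∀ (u v : Cube n) → M u v → Adj u v)
  × (∀ (u v : Cube n) → M u v → M v u)
  × (∀ (u v w : Cube n) → M u v → M u w → v ≡ w)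

IsBreakerPairing : (n k : ℕ) → EdgeSet n → Set
IsBreakerPairing n k M =
    IsMatching M
  × (∀ (p : Pattern n) → dim p ≡ k →
       ∃[ u ] ∃[ v ] (M u v × u ∈C p × v ∈C p))

-- Write a vertex of Q_{4n} as four blocks in Q_n. The parities of the blocks form a vertex of
-- Q₄, which a fixed perfect matching of Q₄ meeting every 2-face turns into an active block i,
-- insensitive to the parity of block i itself. The vertex is paired inside block i by V_j,
-- where j is the sum of the colours of the other three blocks modulo m.
-- A subcube of dimension (4k−3)∨(n+1) splits into four block subcubes, one of dimension at
-- least k. If two further blocks are nontrivial, their parities can be chosen to activate that
-- block, and V_j pairs two vertices of it. Otherwise the dimension sits in two blocks and the
-- face property activates one of them. A small active block still contains an edge, which
-- lies in some V_j, and then the other block has dimension at least n+2−k, so it contains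
-- vertices of every parity and colour and the colour sum can be steered to j.

module Submission where

open import Defs
open import Data.Nat using (ℕ; zero; suc; _+_; _*_; _∸_; _⊔_; _≤_; _<_; _≤?_; z≤n; s≤s; NonZero; >-nonZero)
open import Data.Nat.Properties
  using (+-identityʳ; +-assoc; +-comm; +-suc; +-mono-≤; +-monoʳ-≤; +-cancelˡ-<; ≤-trans; ≤-reflexive;
         ≤-<-trans; ≰⇒>; <⇒≱; n<1⇒n≡0; n<1+n; m≤n⇒m≤1+n; m≤m+n; m∸n+n≡m; m≤n+m∸n; m≤n+o⇒m∸n≤o;
         m≤m⊔n; m≤n⊔m; +-commutativeSemigroup; module ≤-Reasoning)
open import Algebra.Properties.CommutativeSemigroup +-commutativeSemigroup using (x∙yz≈y∙xz)
open import Data.Nat.DivMod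
  using (_mod_; _%_; _/_; %-distribˡ-+; m%n%n≡m%n; m≡m%n+[m/n]*n; [m+kn]%n≡m%n; m<n⇒m%n≡m; m%n≤n)
open import Data.Bool using (Bool; true; false; _xor_; if_then_else_)
open import Data.Bool.Properties using (xor-assoc; xor-same; xor-identityʳ)
open import Data.Maybe using (Maybe; just; nothing)
open import Data.Vec using (Vec; []; _∷_; lookup; _++_; concat; group; map; sum; _[_]≔_)
open import Data.Vec.Properties
  using (++-injective; []≔-idempotent; []≔-commutes; []≔-lookup; lookup∘update; lookup∘update′;
         map-[]≔; lookup-map)
open import Data.Vec.Relation.Binary.Pointwise.Inductive as Pointwise using (Pointwise; []; _∷_; concat⁺)
open import Data.Vec.Relation.Binary.Pointwise.Extensional using (ext; extensional⇒inductive; Pointwise-≡⇒≡)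
open import Data.Fin using (Fin; zero; suc; toℕ; punchIn; #_)
open import Data.Fin.Properties
  using (_≟_; all?; any?; toℕ-injective; toℕ-fromℕ<; toℕ<n; punchInᵢ≢i; suc-injective)
open import Data.Product using (_×_; _,_; proj₁; proj₂; ∃; ∃₂; ∃-syntax)
open import Data.Sum using (_⊎_; inj₁; inj₂)
open import Function using (_∘_)
open import Relation.Nullary using (Dec; yes; no; contradiction)
open import Relation.Nullary.Decidable using (¬?; _×-dec_; _⊎-dec_; _→-dec_; map′; toWitness)
open import Relation.Binary.PropositionalEquality

private
  variable
    A : Set
    a b : Bool
    r n : ℕ
    x y u v : Cube n
    p : Pattern n

Fits : Bool → Maybe Bool → Set
Fits a c = ∀ b → c ≡ just b → a ≡ b

_∈ₚ_ : Cube n → Pattern n → Set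
x ∈ₚ p = Pointwise Fits x p

∈C⇒∈ₚ : x ∈C p → x ∈ₚ p
∈C⇒∈ₚ x∈p = extensional⇒inductive (ext x∈p)

∈ₚ⇒∈C : x ∈ₚ p → x ∈C p
∈ₚ⇒∈C = Pointwise.lookup

fits-free : Fits a nothing
fits-free _ ()

fits-fixed : Fits a (just a)
fits-fixed _ refl = refl

dim≤n : (p : Pattern n) → dim p ≤ n
dim≤n []            = z≤n
dim≤n (nothing ∷ p) = s≤s (dim≤n p)
dim≤n (just _ ∷ p)  = m≤n⇒m≤1+n (dim≤n p)

dim-++ : ∀ {n r} (p : Pattern n) (q : Pattern r) → dim (p ++ q) ≡ dim p + dim q
dim-++ []            q = refl
dim-++ (nothing ∷ p) q = cong suc (dim-++ p q)
dim-++ (just _ ∷ p)  q = dim-++ p q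

dim-concat : (ps : Vec (Pattern n) r) → dim (concat ps) ≡ sum (map dim ps)
dim-concat []       = refl
dim-concat (p ∷ ps) = trans (dim-++ p (concat ps)) (cong (dim p +_) (dim-concat ps))

corner : Pattern n → Cube n
corner []            = []
corner (nothing ∷ p) = false ∷ corner p
corner (just b ∷ p)  = b ∷ corner p

corner-∈ : (p : Pattern n) → corner p ∈ₚ p
corner-∈ []            = []
corner-∈ (nothing ∷ p) = fits-free ∷ corner-∈ p
corner-∈ (just b ∷ p)  = fits-fixed ∷ corner-∈ p

point-of-parity : (p : Pattern n) → 1 ≤ dim p → (β : Bool) → ∃[ x ] (x ∈ₚ p × parity x ≡ β)
point-of-parity (nothing ∷ p) _ β =
  (β xor parity (corner p)) ∷ corner p , fits-free ∷ corner-∈ p , β⊕c⊕c≡β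
  where
  β⊕c⊕c≡β : (β xor parity (corner p)) xor parity (corner p) ≡ β
  β⊕c⊕c≡β = trans (xor-assoc β _ _) (trans (cong (β xor_) (xor-same (parity (corner p)))) (xor-identityʳ β))
point-of-parity (just b ∷ p) 1≤dim β with point-of-parity p 1≤dim (b xor β)
... | x , x∈p , px = b ∷ x , fits-fixed ∷ x∈p , b⊕b⊕β≡β
  where
  b⊕b⊕β≡β : b xor parity x ≡ β
  b⊕b⊕β≡β rewrite px = trans (sym (xor-assoc b b β)) (cong (_xor β) (xor-same b))

subcube : (p : Pattern n) (t : ℕ) → t ≤ dim p → ∃[ q ] (dim q ≡ t × (∀ {x} → x ∈ₚ q → x ∈ₚ p))
subcube []            zero    _ = [] , refl , λ x∈q → x∈q
subcube (nothing ∷ p) zero    _ with subcube p zero z≤n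
... | q , dim≡ , q⊆p = just false ∷ q , dim≡ , λ { (_ ∷ x∈q) → fits-free ∷ q⊆p x∈q }
subcube (nothing ∷ p) (suc t) (s≤s t≤d) with subcube p t t≤d
... | q , dim≡ , q⊆p = nothing ∷ q , cong suc dim≡ , λ { (_ ∷ x∈q) → fits-free ∷ q⊆p x∈q }
subcube (just b ∷ p)  t       t≤d with subcube p t t≤d
... | q , dim≡ , q⊆p = just b ∷ q , dim≡ , λ { (a≡b ∷ x∈q) → a≡b ∷ q⊆p x∈q }

data Neighbour : Cube n → Cube n → Set where
  here  : a ≢ b → Neighbour (a ∷ u) (b ∷ u)
  there : Neighbour u v → Neighbour (a ∷ u) (a ∷ v)

Neighbour⇒Adj : Neighbour u v → Adj u v
Neighbour⇒Adj (here a≢b) = zero , a≢b , λ { zero 0≢0 → contradiction refl 0≢0 ; (suc j) _ → refl }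
Neighbour⇒Adj (there u∼v) with Neighbour⇒Adj u∼v
... | i , differ , agree = suc i , differ , λ { zero _ → refl ; (suc j) j≢i → agree j (j≢i ∘ cong suc) }

Adj⇒Neighbour : Adj u v → Neighbour u v
Adj⇒Neighbour {u = a ∷ u} {b ∷ v} (zero , a≢b , agree) =
  subst (Neighbour (a ∷ u) ∘ (b ∷_)) (Pointwise-≡⇒≡ (ext λ j → agree (suc j) λ ())) (here a≢b)
Adj⇒Neighbour {u = a ∷ u} {b ∷ v} (suc i , differ , agree) =
  subst (λ c → Neighbour (a ∷ u) (c ∷ v)) (agree zero λ ())
    (there (Adj⇒Neighbour (i , differ , λ j j≢i → agree (suc j) (j≢i ∘ suc-injective))))

Neighbour-++ˡ : (w : Cube r) → Neighbour u v → Neighbour (w ++ u) (w ++ v)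
Neighbour-++ˡ []      u∼v = u∼v
Neighbour-++ˡ (_ ∷ w) u∼v = there (Neighbour-++ˡ w u∼v)

Neighbour-++ʳ : (w : Cube r) → Neighbour u v → Neighbour (u ++ w) (v ++ w)
Neighbour-++ʳ w (here a≢b)  = here a≢b
Neighbour-++ʳ w (there u∼v) = there (Neighbour-++ʳ w u∼v)

Neighbour-concat : (xs : Vec (Cube n) r) (i : Fin r) →
                   Neighbour (lookup xs i) y → Neighbour (concat xs) (concat (xs [ i ]≔ y))
Neighbour-concat (x ∷ xs) zero    x∼y = Neighbour-++ʳ (concat xs) x∼y
Neighbour-concat (x ∷ xs) (suc i) x∼y = Neighbour-++ˡ x (Neighbour-concat xs i x∼y)

neighbours-in : (p : Pattern n) → 1 ≤ dim p → ∃₂ λ u v → u ∈ₚ p × v ∈ₚ p × Neighbour u v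
neighbours-in (nothing ∷ p) _ =
  false ∷ corner p , true ∷ corner p , fits-free ∷ corner-∈ p , fits-free ∷ corner-∈ p , here λ ()
neighbours-in (just b ∷ p) 1≤dim with neighbours-in p 1≤dim
... | u , v , u∈p , v∈p , u∼v = b ∷ u , b ∷ v , fits-fixed ∷ u∈p , fits-fixed ∷ v∈p , there u∼v

concat-injective : (xss yss : Vec (Vec A n) r) → concat xss ≡ concat yss → xss ≡ yss
concat-injective []         []         _  = refl
concat-injective (xs ∷ xss) (ys ∷ yss) eq with ++-injective xs ys eq
... | refl , rest = cong (xs ∷_) (concat-injective xss yss rest)

blocks : ∀ r → Vec A (r * n) → Vec (Vec A n) r
blocks {n = n} r xs = proj₁ (group r n xs)

concat-blocks : ∀ r (xs : Vec A (r * n)) → concat (blocks r xs) ≡ xs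
concat-blocks {n = n} r xs = sym (proj₂ (group r n xs))

blocks-concat : (xss : Vec (Vec A n) r) → blocks r (concat xss) ≡ xss
blocks-concat {r = r} xss = concat-injective _ xss (concat-blocks r (concat xss))

sum-[]≔ : (ws : Vec ℕ r) (i : Fin r) (w : ℕ) → sum (ws [ i ]≔ w) ≡ w + sum (ws [ i ]≔ 0)
sum-[]≔ (v ∷ ws) zero    w = refl
sum-[]≔ (v ∷ ws) (suc i) w =
  trans (cong (v +_) (sum-[]≔ ws i w)) (x∙yz≈y∙xz v w (sum (ws [ i ]≔ 0)))

sum-lookup : (ws : Vec ℕ r) (i : Fin r) → sum ws ≡ lookup ws i + sum (ws [ i ]≔ 0)
sum-lookup ws i = trans (cong sum (sym ([]≔-lookup ws i))) (sum-[]≔ ws i (lookup ws i))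

sum-zero : (ws : Vec ℕ r) → (∀ t → lookup ws t ≡ 0) → sum ws ≡ 0
sum-zero []       _     = refl
sum-zero (w ∷ ws) zeros = cong₂ _+_ (zeros zero) (sum-zero ws (zeros ∘ suc))

sum-supported : (ws : Vec ℕ r) (i : Fin r) → (∀ t → t ≢ i → lookup ws t ≡ 0) → sum ws ≡ lookup ws i
sum-supported ws i zeros = begin
  sum ws                                 ≡⟨ sum-lookup ws i ⟩
  lookup ws i + sum (ws [ i ]≔ 0)        ≡⟨ cong (lookup ws i +_) (sum-zero (ws [ i ]≔ 0) cleared) ⟩
  lookup ws i + 0                        ≡⟨ +-identityʳ _ ⟩
  lookup ws i                            ∎
  where
  open ≡-Reasoning
  cleared : ∀ t → lookup (ws [ i ]≔ 0) t ≡ 0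
  cleared t with t ≟ i
  ... | yes refl = lookup∘update t ws 0
  ... | no t≢i   = trans (lookup∘update′ t≢i ws 0) (zeros t t≢i)

sum-bounded : (ws : Vec ℕ r) {k : ℕ} → (∀ t → lookup ws t < k) → sum ws + r ≤ r * k
sum-bounded []       _       = z≤n
sum-bounded {suc r} (w ∷ ws) {k} bound = begin
  w + sum ws + suc r             ≡⟨ +-suc (w + sum ws) r ⟩
  suc (w + sum ws + r)           ≡⟨ cong suc (+-assoc w (sum ws) r) ⟩
  suc w + (sum ws + r)           ≤⟨ +-mono-≤ (bound zero) (sum-bounded ws (bound ∘ suc)) ⟩
  k + r * k                      ∎
  where open ≤-Reasoning

pigeonhole : (ws : Vec ℕ r) {k : ℕ} → r * k < sum ws + r → ∃[ i ] (k ≤ lookup ws i)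
pigeonhole ws {k} large with any? (λ i → k ≤? lookup ws i)
... | yes found = found
... | no  none  = contradiction (sum-bounded ws λ t → ≰⇒> (none ∘ (t ,_))) (<⇒≱ large)

heavy-pair-or-sum : (ws : Vec ℕ (suc (suc r))) (i : Fin (suc (suc r))) →
  (∃₂ λ a b → a ≢ i × b ≢ i × b ≢ a × 1 ≤ lookup ws a × 1 ≤ lookup ws b)
  ⊎ (∃[ a ] (a ≢ i × sum ws ≡ lookup ws i + lookup ws a))
heavy-pair-or-sum ws i with any? (λ a → ¬? (a ≟ i) ×-dec 1 ≤? lookup ws a)
... | no none = inj₂ (a₀ , a₀≢i , sum≡)
  where
  open ≡-Reasoning
  a₀ = punchIn i zero
  a₀≢i = punchInᵢ≢i i zero
  others-zero : ∀ t → t ≢ i → lookup ws t ≡ 0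
  others-zero t t≢i = n<1⇒n≡0 (≰⇒> λ positive → none (t , t≢i , positive))
  sum≡ : sum ws ≡ lookup ws i + lookup ws a₀
  sum≡ = begin
    sum ws                     ≡⟨ sum-supported ws i others-zero ⟩
    lookup ws i                ≡⟨ +-identityʳ _ ⟨
    lookup ws i + 0            ≡⟨ cong (lookup ws i +_) (others-zero a₀ a₀≢i) ⟨
    lookup ws i + lookup ws a₀ ∎
... | yes (a , a≢i , a-positive)
  with any? (λ b → ¬? (b ≟ i) ×-dec ¬? (b ≟ a) ×-dec 1 ≤? lookup ws b)
...   | yes (b , b≢i , b≢a , b-positive) = inj₁ (a , b , a≢i , b≢i , b≢a , a-positive , b-positive)
...   | no none = inj₂ (a , a≢i , sum≡)
  where
  open ≡-Reasoning
  zero-off-i : ∀ t → t ≢ i → lookup (ws [ a ]≔ 0) t ≡ 0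
  zero-off-i t t≢i with t ≟ a
  zero-off-i t t≢i | yes refl = lookup∘update t ws 0
  zero-off-i t t≢i | no t≢a   = trans (lookup∘update′ t≢a ws 0)
                         (n<1⇒n≡0 (≰⇒> λ positive → none (t , t≢i , t≢a , positive)))
  sum≡ : sum ws ≡ lookup ws i + lookup ws a
  sum≡ = begin
    sum ws                             ≡⟨ sum-lookup ws a ⟩
    lookup ws a + sum (ws [ a ]≔ 0)    ≡⟨ cong (lookup ws a +_) (sum-supported (ws [ a ]≔ 0) i zero-off-i) ⟩
    lookup ws a + lookup (ws [ a ]≔ 0) i ≡⟨ cong (lookup ws a +_) (lookup∘update′ (a≢i ∘ sym) ws 0) ⟩
    lookup ws a + lookup ws i          ≡⟨ +-comm (lookup ws a) (lookup ws i) ⟩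
    lookup ws i + lookup ws a          ∎

+-mod-surjective : ∀ m .{{_ : NonZero m}} (R : ℕ) (j : Fin m) → ∃[ c ] ((toℕ c + R) mod m ≡ j)
+-mod-surjective m R j = w mod m , toℕ-injective shifted
  where
  open ≡-Reasoning
  s = m ∸ R % m
  q = R / m
  w = toℕ j + s
  regroup : ∀ a b c d → a + b + (c + d) ≡ a + ((b + c) + d)
  regroup a b c d = trans (+-assoc a b (c + d)) (cong (a +_) (sym (+-assoc b c d)))
  shifted : toℕ ((toℕ (w mod m) + R) mod m) ≡ toℕ j
  shifted = begin
    toℕ ((toℕ (w mod m) + R) mod m)         ≡⟨ toℕ-fromℕ< _ ⟩
    (toℕ (w mod m) + R) % m                 ≡⟨ cong (λ z → (z + R) % m) (toℕ-fromℕ< _) ⟩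
    (w % m + R) % m                         ≡⟨ %-distribˡ-+ (w % m) R m ⟩
    (w % m % m + R % m) % m                 ≡⟨ cong (λ z → (z + R % m) % m) (m%n%n≡m%n w m) ⟩
    (w % m + R % m) % m                     ≡⟨ %-distribˡ-+ w R m ⟨
    (w + R) % m                             ≡⟨ cong (λ z → (w + z) % m) (m≡m%n+[m/n]*n R m) ⟩
    (toℕ j + s + (R % m + q * m)) % m       ≡⟨ cong (_% m) (regroup (toℕ j) s (R % m) (q * m)) ⟩
    (toℕ j + ((s + R % m) + q * m)) % m     ≡⟨ cong (λ z → (toℕ j + (z + q * m)) % m) (m∸n+n≡m (m%n≤n R m)) ⟩
    (toℕ j + suc q * m) % m                 ≡⟨ [m+kn]%n≡m%n (toℕ j) (suc q) m ⟩
    toℕ j % m                               ≡⟨ m<n⇒m%n≡m (toℕ<n j) ⟩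
    toℕ j                                   ∎

∀-Bool? : {P : Bool → Set} → (∀ b → Dec (P b)) → Dec (∀ b → P b)
∀-Bool? P? = map′ (λ (pf , pt) → λ { false → pf ; true → pt }) (λ all → all false , all true)
                  (P? false ×-dec P? true)

∃-Bool? : {P : Bool → Set} → (∀ b → Dec (P b)) → Dec (∃ P)
∃-Bool? P? = map′ (λ { (inj₁ pf) → false , pf ; (inj₂ pt) → true , pt })
                  (λ { (false , pf) → inj₁ pf ; (true , pt) → inj₂ pt })
                  (P? false ⊎-dec P? true)

∀-Vec? : {P : Vec Bool r → Set} → (∀ v → Dec (P v)) → Dec (∀ v → P v)
∀-Vec? {zero}  P? = map′ (λ p → λ { [] → p }) (λ all → all []) (P? [])
∀-Vec? {suc r} P? = map′ (λ all → λ { (b ∷ v) → all b v }) (λ all b v → all (b ∷ v))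
                         (∀-Bool? λ b → ∀-Vec? λ v → P? (b ∷ v))

-- select⁻¹ i is a pair of antipodal edges of Q₄ in direction i. These eight edges form a
-- perfect matching of Q₄ that meets every 2-dimensional face in an edge of that face.
select : Vec Bool 4 → Fin 4
select (false ∷ false ∷ false ∷ false ∷ []) = # 2
select (false ∷ false ∷ false ∷ true  ∷ []) = # 0
select (false ∷ false ∷ true  ∷ false ∷ []) = # 2
select (false ∷ false ∷ true  ∷ true  ∷ []) = # 1
select (false ∷ true  ∷ false ∷ false ∷ []) = # 3
select (false ∷ true  ∷ false ∷ true  ∷ []) = # 3
select (false ∷ true  ∷ true  ∷ false ∷ []) = # 0
select (false ∷ true  ∷ true  ∷ true  ∷ []) = # 1
select (true  ∷ false ∷ false ∷ false ∷ []) = # 1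
select (true  ∷ false ∷ false ∷ true  ∷ []) = # 0
select (true  ∷ false ∷ true  ∷ false ∷ []) = # 3
select (true  ∷ false ∷ true  ∷ true  ∷ []) = # 3
select (true  ∷ true  ∷ false ∷ false ∷ []) = # 1
select (true  ∷ true  ∷ false ∷ true  ∷ []) = # 2
select (true  ∷ true  ∷ true  ∷ false ∷ []) = # 0
select (true  ∷ true  ∷ true  ∷ true  ∷ []) = # 2

-- Opaque, so that the exhaustive decisions are not unfolded where these facts are used.
opaque
  select-≔ : ∀ π b → select (π [ select π ]≔ b) ≡ select π
  select-≔ = toWitness {a? = ∀-Vec? λ π → ∀-Bool? λ b → select (π [ select π ]≔ b) ≟ select π} _

  select-free-pair : ∀ ζ i a b → a ≢ i → b ≢ i → b ≢ a →
                      ∃₂ λ x y → select (ζ [ a ]≔ x [ b ]≔ y) ≡ i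
  select-free-pair = toWitness {a? = ∀-Vec? λ ζ → all? λ i → all? λ a → all? λ b →
    ¬? (a ≟ i) →-dec ¬? (b ≟ i) →-dec ¬? (b ≟ a) →-dec
    ∃-Bool? λ x → ∃-Bool? λ y → select (ζ [ a ]≔ x [ b ]≔ y) ≟ i} _

  select-free-face : ∀ ζ i a → a ≢ i →
                ∃₂ λ x y → select (ζ [ i ]≔ x [ a ]≔ y) ≡ i ⊎ select (ζ [ i ]≔ x [ a ]≔ y) ≡ a
  select-free-face = toWitness {a? = ∀-Vec? λ ζ → all? λ i → all? λ a →
    ¬? (a ≟ i) →-dec
    ∃-Bool? λ x → ∃-Bool? λ y → select (ζ [ i ]≔ x [ a ]≔ y) ≟ i ⊎-dec select (ζ [ i ]≔ x [ a ]≔ y) ≟ a} _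

positive-summand : ∀ {x y} → x ≤ n → n < x + y → 1 ≤ y
positive-summand {n} {x} {y} x≤n n<x+y =
  +-cancelˡ-< x 0 y (≤-<-trans (≤-trans (≤-reflexive (+-identityʳ x)) x≤n) n<x+y)

large-summand : ∀ {x y k} → n < x + y → y < k → n + 2 ∸ k ≤ x
large-summand {n} {x} {y} {k} n<x+y y<k = m≤n+o⇒m∸n≤o (n + 2) k (begin
  n + 2        ≡⟨ +-comm n 2 ⟩
  suc (suc n)  ≤⟨ s≤s n<x+y ⟩
  suc (x + y)  ≡⟨ +-suc x y ⟨
  x + suc y    ≤⟨ +-monoʳ-≤ x y<k ⟩
  x + k        ≡⟨ +-comm x k ⟩
  k + x        ∎)
  where open ≤-Reasoning

module Construction
  (n k m : ℕ) .{{_ : NonZero m}}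
  (V : Fin m → EdgeSet n)
  (V-pairing : ∀ j → IsBreakerPairing n k (V j))
  (V-covers : ∀ (u v : Cube n) → Adj u v → ∃[ j ] V j u v)
  (cE cO : Cube n → Fin m)
  (cE-dense : ∀ (p : Pattern n) → dim p + k ≡ n + 2 → (j : Fin m) →
                ∃[ x ] (x ∈C p × InE x × cE x ≡ j))
  (cO-dense : ∀ (p : Pattern n) → dim p + k ≡ n + 2 → (j : Fin m) →
                ∃[ x ] (x ∈C p × InO x × cO x ≡ j))
  where

  V-adj : ∀ {j u v} → V j u v → Adj u v
  V-adj {j} = proj₁ (proj₁ (V-pairing j)) _ _

  V-sym : ∀ {j u v} → V j u v → V j v u
  V-sym {j} = proj₁ (proj₂ (proj₁ (V-pairing j))) _ _

  V-functional : ∀ {j u v w} → V j u v → V j u w → v ≡ w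
  V-functional {j} = proj₂ (proj₂ (proj₁ (V-pairing j))) _ _ _

  colour : Cube n → Fin m
  colour x = (if parity x then cO else cE) x

  coloured-point : (p : Pattern n) → dim p + k ≡ n + 2 → (β : Bool) (c : Fin m) →
                 ∃[ x ] (x ∈C p × parity x ≡ β × colour x ≡ c)
  coloured-point p dim≡ false c with cE-dense p dim≡ c
  ... | x , x∈p , even , cx = x , x∈p , even , trans (cong (λ β → (if β then cO else cE) x) even) cx
  coloured-point p dim≡ true  c with cO-dense p dim≡ c
  ... | x , x∈p , odd  , cx = x , x∈p , odd  , trans (cong (λ β → (if β then cO else cE) x) odd) cx

  Blocks : Set
  Blocks = Vec (Cube n) 4

  index : Fin 4 → Blocks → Fin m
  index i xs = sum (map (toℕ ∘ colour) xs [ i ]≔ 0) mod m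

  index-≔ : ∀ xs i x → index i (xs [ i ]≔ x) ≡ index i xs
  index-≔ xs i x = cong (λ ws → sum ws mod m) (begin
    map f (xs [ i ]≔ x) [ i ]≔ 0   ≡⟨ cong (_[ i ]≔ 0) (map-[]≔ f xs i) ⟩
    map f xs [ i ]≔ f x [ i ]≔ 0   ≡⟨ []≔-idempotent (map f xs) i ⟩
    map f xs [ i ]≔ 0              ∎)
    where
    open ≡-Reasoning
    f = toℕ ∘ colour

  index-tunable : ∀ xs {i a} → i ≢ a → (j : Fin m) →
                  ∃[ c ] (∀ y → colour y ≡ c → index a (xs [ i ]≔ y) ≡ j)
  index-tunable xs {i} {a} i≢a j = c , tuned
    where
    open ≡-Reasoning
    f = toℕ ∘ colour
    R = sum (map f xs [ a ]≔ 0 [ i ]≔ 0)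
    c = proj₁ (+-mod-surjective m R j)
    tuned : ∀ y → colour y ≡ c → index a (xs [ i ]≔ y) ≡ j
    tuned y cy = begin
      sum (map f (xs [ i ]≔ y) [ a ]≔ 0) mod m   ≡⟨ cong (λ ws → sum (ws [ a ]≔ 0) mod m) (map-[]≔ f xs i) ⟩
      sum (map f xs [ i ]≔ f y [ a ]≔ 0) mod m   ≡⟨ cong (λ ws → sum ws mod m) ([]≔-commutes (map f xs) i a i≢a) ⟩
      sum (map f xs [ a ]≔ 0 [ i ]≔ f y) mod m   ≡⟨ cong (_mod m) (sum-[]≔ (map f xs [ a ]≔ 0) i (f y)) ⟩
      (f y + R) mod m                            ≡⟨ cong (λ z → (toℕ z + R) mod m) cy ⟩
      (toℕ c + R) mod m                          ≡⟨ proj₂ (+-mod-surjective m R j) ⟩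
      j                                          ∎

  active : Blocks → Fin 4
  active xs = select (map parity xs)

  active-≔ : ∀ xs x → active (xs [ active xs ]≔ x) ≡ active xs
  active-≔ xs x = trans (cong select (map-[]≔ parity xs (active xs))) (select-≔ (map parity xs) (parity x))

  active-≔-parity : ∀ xs i x → parity x ≡ parity (lookup xs i) → active (xs [ i ]≔ x) ≡ active xs
  active-≔-parity xs i x same = cong select (begin
    map parity (xs [ i ]≔ x)                         ≡⟨ map-[]≔ parity xs i ⟩
    map parity xs [ i ]≔ parity x                    ≡⟨ cong (map parity xs [ i ]≔_) same ⟩
    map parity xs [ i ]≔ parity (lookup xs i)        ≡⟨ cong (map parity xs [ i ]≔_) (lookup-map i parity xs) ⟨
    map parity xs [ i ]≔ lookup (map parity xs) i    ≡⟨ []≔-lookup (map parity xs) i ⟩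
    map parity xs                                    ∎)
    where open ≡-Reasoning

  Move : Blocks → Blocks → Set
  Move xs ys = ∃[ y ] (ys ≡ xs [ active xs ]≔ y × V (index (active xs) xs) (lookup xs (active xs)) y)

  Move-intro : ∀ xs {i u v} → active xs ≡ i → V (index i xs) u v → Move (xs [ i ]≔ u) (xs [ i ]≔ v)
  Move-intro xs {u = u} {v} refl uv rewrite active-≔ xs u =
    v , sym ([]≔-idempotent xs (active xs)) ,
    subst₂ (λ j w → V j w v) (sym (index-≔ xs (active xs) u)) (sym (lookup∘update (active xs) xs u)) uv

  Move-sym : ∀ {xs ys} → Move xs ys → Move ys xs
  Move-sym {xs} (y , refl , xy) =
    subst (Move (xs [ active xs ]≔ y)) ([]≔-lookup xs (active xs)) (Move-intro xs refl (V-sym xy))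

  Move-functional : ∀ {xs ys zs} → Move xs ys → Move xs zs → ys ≡ zs
  Move-functional {xs} (y , refl , xy) (z , refl , xz) = cong (xs [ active xs ]≔_) (V-functional xy xz)

  Move-neighbour : ∀ {xs ys} → Move xs ys → Neighbour (concat xs) (concat ys)
  Move-neighbour {xs} (y , refl , xy) = Neighbour-concat xs (active xs) (Adj⇒Neighbour (V-adj xy))

  split : Vec A (4 * n) → Vec (Vec A n) 4
  split = blocks 4

  concat-split : (xs : Vec A (4 * n)) → concat (split xs) ≡ xs
  concat-split = concat-blocks {n = n} 4

  M : EdgeSet (4 * n)
  M u v = Move (split u) (split v)

  M-matching : IsMatching M
  M-matching =
    (λ u v uv → subst₂ Adj (concat-split u) (concat-split v) (Neighbour⇒Adj (Move-neighbour uv))) ,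
    (λ _ _ → Move-sym) ,
    (λ u v w uv uw →
       trans (sym (concat-split v)) (trans (cong concat (Move-functional uv uw)) (concat-split w)))

  B : ℕ
  B = (4 * k ∸ 3) ⊔ (n + 1)

  n<B : n < B
  n<B = ≤-trans (≤-reflexive (+-comm 1 n)) (m≤n⊔m (4 * k ∸ 3) (n + 1))

  module Covering (ps : Vec (Pattern n) 4) where

    d : Fin 4 → ℕ
    d t = dim (lookup ps t)

    Inside : Blocks → Set
    Inside xs = ∀ t → lookup xs t ∈ₚ lookup ps t

    Inside-≔ : ∀ xs i x → Inside xs → x ∈ₚ lookup ps i → Inside (xs [ i ]≔ x)
    Inside-≔ xs i x xs∈ x∈ t with t ≟ i
    ... | yes refl = subst (_∈ₚ lookup ps t) (sym (lookup∘update t xs x)) x∈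
    ... | no t≢i   = subst (_∈ₚ lookup ps t) (sym (lookup∘update′ t≢i xs x)) (xs∈ t)

    Inside⇒∈C : ∀ xs → Inside xs → concat xs ∈C concat ps
    Inside⇒∈C xs xs∈ = ∈ₚ⇒∈C (concat⁺ (extensional⇒inductive {xs = xs} {ys = ps} (ext xs∈)))

    MoveInside : Set
    MoveInside = ∃₂ λ xs ys → Inside xs × Inside ys × Move xs ys

    MoveInside⇒edge : MoveInside → ∃[ u ] ∃[ v ] (M u v × u ∈C concat ps × v ∈C concat ps)
    MoveInside⇒edge (xs , ys , xs∈ , ys∈ , move) =
      concat xs , concat ys ,
      subst₂ Move (sym (blocks-concat {n = n} xs)) (sym (blocks-concat {n = n} ys)) move ,
      Inside⇒∈C xs xs∈ , Inside⇒∈C ys ys∈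

    base : Blocks
    base = map corner ps

    base-inside : Inside base
    base-inside t = subst (_∈ₚ lookup ps t) (sym (lookup-map t corner ps)) (corner-∈ (lookup ps t))

    ζ : Vec Bool 4
    ζ = map parity base

    inside-with-parities : ∀ s t → 1 ≤ d s → 1 ≤ d t → (β γ : Bool) →
                           ∃[ xs ] (Inside xs × map parity xs ≡ ζ [ s ]≔ β [ t ]≔ γ)
    inside-with-parities s t 1≤ds 1≤dt β γ
      with point-of-parity (lookup ps s) 1≤ds β | point-of-parity (lookup ps t) 1≤dt γ
    ... | y , y∈ , py | z , z∈ , pz =
      base [ s ]≔ y [ t ]≔ z ,
      Inside-≔ (base [ s ]≔ y) t z (Inside-≔ base s y base-inside y∈) z∈ ,
      (begin
        map parity (base [ s ]≔ y [ t ]≔ z)        ≡⟨ map-[]≔ parity (base [ s ]≔ y) t ⟩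
        map parity (base [ s ]≔ y) [ t ]≔ parity z ≡⟨ cong (_[ t ]≔ parity z) (map-[]≔ parity base s) ⟩
        ζ [ s ]≔ parity y [ t ]≔ parity z          ≡⟨ cong₂ (λ β γ → ζ [ s ]≔ β [ t ]≔ γ) py pz ⟩
        ζ [ s ]≔ β [ t ]≔ γ                        ∎)
      where open ≡-Reasoning

    inside-active-at : ∀ {i a b} → a ≢ i → b ≢ i → b ≢ a → 1 ≤ d a → 1 ≤ d b →
                       ∃[ xs ] (Inside xs × active xs ≡ i)
    inside-active-at {i} {a} {b} a≢i b≢i b≢a 1≤da 1≤db with select-free-pair ζ i a b a≢i b≢i b≢a
    ... | x , y , selected with inside-with-parities a b 1≤da 1≤db x y
    ... | xs , xs∈ , parities = xs , xs∈ , trans (cong select parities) selected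

    inside-active-in-face : ∀ {i a} → a ≢ i → 1 ≤ d i → 1 ≤ d a →
                            ∃[ xs ] (Inside xs × (active xs ≡ i ⊎ active xs ≡ a))
    inside-active-in-face {i} {a} a≢i 1≤di 1≤da with select-free-face ζ i a a≢i
    ... | x , y , selected with inside-with-parities i a 1≤di 1≤da x y
    ... | xs , xs∈ , parities = xs , xs∈ , subst (λ π → select π ≡ i ⊎ select π ≡ a) (sym parities) selected

    move-inside-large : ∀ xs {i} → Inside xs → active xs ≡ i → k ≤ d i → MoveInside
    move-inside-large xs {i} xs∈ active≡i k≤d with subcube (lookup ps i) k k≤d
    ... | q , dim-q , q⊆ with proj₂ (V-pairing (index i xs)) q dim-q
    ... | u , v , uv , u∈q , v∈q =
      xs [ i ]≔ u , xs [ i ]≔ v ,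
      Inside-≔ xs i u xs∈ (q⊆ (∈C⇒∈ₚ u∈q)) , Inside-≔ xs i v xs∈ (q⊆ (∈C⇒∈ₚ v∈q)) ,
      Move-intro xs active≡i uv

    recolour : (xs : Blocks) (i : Fin 4) → k ≤ n → n + 2 ∸ k ≤ d i → (c : Fin m) →
               ∃ λ (y : Cube n) → y ∈ₚ lookup ps i × parity y ≡ parity (lookup xs i) × colour y ≡ c
    recolour xs i k≤n large c with subcube (lookup ps i) (n + 2 ∸ k) large
    ... | q , dim-q , q⊆ with coloured-point q dim≡ (parity (lookup xs i)) c
      where
      dim≡ : dim q + k ≡ n + 2
      dim≡ = trans (cong (_+ k) dim-q) (m∸n+n≡m (≤-trans k≤n (m≤m+n n 2)))
    ... | y , y∈q , py , cy = y , q⊆ (∈C⇒∈ₚ y∈q) , py , cy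

    move-inside-steered : ∀ xs {i a} → Inside xs → i ≢ a → active xs ≡ a →
                          1 ≤ d a → k ≤ n → n + 2 ∸ k ≤ d i → MoveInside
    move-inside-steered xs {i} {a} xs∈ i≢a active≡a 1≤da k≤n large with neighbours-in (lookup ps a) 1≤da
    ... | e , e′ , e∈ , e′∈ , e∼e′ with V-covers e e′ (Neighbour⇒Adj e∼e′)
    ... | j , ee′ with index-tunable xs i≢a j
    ... | c , tuned with recolour xs i k≤n large c
    ... | y , y∈ , py , cy =
      xs [ i ]≔ y [ a ]≔ e , xs [ i ]≔ y [ a ]≔ e′ ,
      Inside-≔ (xs [ i ]≔ y) a e (Inside-≔ xs i y xs∈ y∈) e∈ ,
      Inside-≔ (xs [ i ]≔ y) a e′ (Inside-≔ xs i y xs∈ y∈) e′∈ ,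
      Move-intro (xs [ i ]≔ y) (trans (active-≔-parity xs i y py) active≡a)
                 (subst (λ j → V j e e′) (sym (tuned y cy)) ee′)

    lookup-dims : ∀ t → lookup (map dim ps) t ≡ d t
    lookup-dims t = lookup-map t dim ps

    move-inside-three : ∀ {i a b} → a ≢ i → b ≢ i → b ≢ a → k ≤ d i → 1 ≤ d a → 1 ≤ d b → MoveInside
    move-inside-three a≢i b≢i b≢a k≤di 1≤da 1≤db with inside-active-at a≢i b≢i b≢a 1≤da 1≤db
    ... | xs , xs∈ , active≡i = move-inside-large xs xs∈ active≡i k≤di

    move-inside-two : ∀ {i a} → a ≢ i → k ≤ d i → n < d i + d a → MoveInside
    move-inside-two {i} {a} a≢i k≤di n<di+da with inside-active-in-face a≢i 1≤di 1≤da
      where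
      1≤di : 1 ≤ d i
      1≤di = positive-summand (dim≤n (lookup ps a)) (subst (n <_) (+-comm (d i) (d a)) n<di+da)
      1≤da : 1 ≤ d a
      1≤da = positive-summand (dim≤n (lookup ps i)) n<di+da
    ... | xs , xs∈ , inj₁ active≡i = move-inside-large xs xs∈ active≡i k≤di
    ... | xs , xs∈ , inj₂ active≡a with k ≤? d a
    ...   | yes k≤da = move-inside-large xs xs∈ active≡a k≤da
    ...   | no  k≰da = move-inside-steered xs xs∈ (a≢i ∘ sym) active≡a
                         (positive-summand (dim≤n (lookup ps i)) n<di+da)
                         (≤-trans k≤di (dim≤n (lookup ps i)))
                         (large-summand n<di+da (≰⇒> k≰da))

    move-inside : dim (concat ps) ≡ B → MoveInside
    move-inside dim≡B with pigeonhole (map dim ps) mass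
      where
      open ≤-Reasoning
      mass : 4 * k < sum (map dim ps) + 4
      mass = begin-strict
        4 * k                ≤⟨ m≤n+m∸n (4 * k) 3 ⟩
        3 + (4 * k ∸ 3)      ≤⟨ +-monoʳ-≤ 3 (m≤m⊔n (4 * k ∸ 3) (n + 1)) ⟩
        3 + B                <⟨ n<1+n (3 + B) ⟩
        4 + B                ≡⟨ +-comm 4 B ⟩
        B + 4                ≡⟨ cong (_+ 4) (trans (sym dim≡B) (dim-concat ps)) ⟩
        sum (map dim ps) + 4 ∎
    ... | i , k≤di with heavy-pair-or-sum (map dim ps) i
    ... | inj₁ (a , b , a≢i , b≢i , b≢a , 1≤da , 1≤db) =
      move-inside-three a≢i b≢i b≢a (subst (k ≤_) (lookup-dims i) k≤di)
                        (subst (1 ≤_) (lookup-dims a) 1≤da) (subst (1 ≤_) (lookup-dims b) 1≤db)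
    ... | inj₂ (a , a≢i , sum≡) =
      move-inside-two a≢i (subst (k ≤_) (lookup-dims i) k≤di) (subst (n <_) B≡di+da n<B)
      where
      B≡di+da : B ≡ d i + d a
      B≡di+da = begin
        B                                         ≡⟨ dim≡B ⟨
        dim (concat ps)                           ≡⟨ dim-concat ps ⟩
        sum (map dim ps)                          ≡⟨ sum≡ ⟩
        lookup (map dim ps) i + lookup (map dim ps) a ≡⟨ cong₂ _+_ (lookup-dims i) (lookup-dims a) ⟩
        d i + d a                                 ∎
        where open ≡-Reasoning

  M-pairing : IsBreakerPairing (4 * n) B M
  M-pairing = M-matching , λ P dim-P →
    subst (λ Q → ∃[ u ] ∃[ v ] (M u v × u ∈C Q × v ∈C Q)) (concat-split P)
          (MoveInside⇒edge (split P) (move-inside (split P) (trans (cong dim (concat-split P)) dim-P)))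
    where open Covering

theorem4 : (n k m : ℕ) → 1 ≤ n → 1 ≤ k → 1 ≤ m →
    (V : Fin m → EdgeSet n) →
    (∀ j → IsBreakerPairing n k (V j)) →
    (∀ (u v : Cube n) → Adj u v → ∃[ j ] V j u v) →
    (cE : Cube n → Fin m) →
    (cO : Cube n → Fin m) →
    (∀ (p : Pattern n) → dim p + k ≡ n + 2 → (j : Fin m) →
       ∃[ x ] (x ∈C p × InE x × cE x ≡ j)) →
    (∀ (p : Pattern n) → dim p + k ≡ n + 2 → (j : Fin m) →
       ∃[ x ] (x ∈C p × InO x × cO x ≡ j)) →
    ∃[ M ] IsBreakerPairing (4 * n) ((4 * k ∸ 3) ⊔ (n + 1)) M
theorem4 n k m _ _ 1≤m V V-pairing V-covers cE cO cE-dense cO-dense = M , M-pairing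
  where open Construction n k m {{>-nonZero 1≤m}} V V-pairing V-covers cE cO cE-dense cO-dense
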